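{- For all $w_1\geq w_2\geq 1$, we have $N_{ccc}((w_1, w_2))= 2w_1w_2+w_2$.
   Context: $(w_1,w_2)$ denotes the ternary composition: codewords of a ternary code have exactly $w_1$ coordinates equal to $1$ and $w_2$ equal to $2$; $w=w_1+w_2$. $A_3(n,d,\overline{w})$ is the maximum size of a ternary length-$n$ code with minimum Hamming distance $d$ and constant composition $\overline{w}$; $N_{ccc}(\overline{w})=\min\{n_0: A_3(n,2w-1,\overline{w})=\lfloor n/w_1\rfloor \text{ for all } n\geq n_0\}$. -}

module Defs where

open import Data.Nat using (ℕ; zero; suc; _+_; _*_; _∸_; _≤_; _<_; NonZero)
open import Data.Nat.DivMod using (_/_)
open import Data.Fin using (Fin)
open import Data.Fin.Patterns using (0F; 1F; 2F)
open import Data.Vec using (Vec; []; _∷_)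
open import Data.List using (List; length)
open import Data.List.Relation.Unary.All using (All)
open import Data.List.Relation.Unary.Unique.Propositional using (Unique)
open import Data.List.Membership.Propositional using (_∈_)
open import Data.Product using (Σ; _×_)
open import Relation.Binary.PropositionalEquality using (_≡_; _≢_)
open import Relation.Nullary using (¬_; yes; no)
open import Data.Fin using (_≟_)

Word : ℕ → Set
Word n = Vec (Fin 3) n

count : ∀ {n} → Fin 3 → Word n → ℕ
count a [] = 0
count a (x ∷ xs) with x ≟ a
... | yes _ = suc (count a xs)
... | no  _ = count a xs

hamming : ∀ {n} → Word n → Word n → ℕ
hamming [] [] = 0
hamming (x ∷ xs) (y ∷ ys) with x ≟ y
... | yes _ = hamming xs ys
... | no  _ = suc (hamming xs ys)

HasComposition : ℕ → ℕ → ∀ {n} → Word n → Set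
HasComposition w1 w2 x = (count 1F x ≡ w1) × (count 2F x ≡ w2)

record CCCode (n d w1 w2 : ℕ) : Set where
  field
    words       : List (Word n)
    distinct    : Unique words
    composition : All (HasComposition w1 w2) words
    minDist     : ∀ {x y} → x ∈ words → y ∈ words → x ≢ y → d ≤ hamming x y

size : ∀ {n d w1 w2} → CCCode n d w1 w2 → ℕ
size C = length (CCCode.words C)

A3≡ : ℕ → ℕ → ℕ → ℕ → ℕ → Set
A3≡ n d w1 w2 m =
  Σ (CCCode n d w1 w2) (λ C → size C ≡ m) × (∀ (C : CCCode n d w1 w2) → size C ≤ m)

Admissible : (w1 w2 : ℕ) → .{{NonZero w1}} → ℕ → Set
Admissible w1 w2 n₀ = ∀ n → n₀ ≤ n → A3≡ n (2 * (w1 + w2) ∸ 1) w1 w2 (n / w1)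

Nccc≡ : (w1 w2 : ℕ) → .{{NonZero w1}} → ℕ → Set
Nccc≡ w1 w2 N = Admissible w1 w2 N × (∀ n₀ → n₀ < N → ¬ Admissible w1 w2 n₀)

module Submission where

-- For words x, y of composition (w1,w2) and w = w1 + w2,
--   d(x,y) + |supp x ∩ supp y| + #{common ones} ≤ 2w,
-- so in a code of minimum distance 2w − 1 two supports meet at most once and
-- the 1-positions of codewords are disjoint.  A Bonferroni inequality (total
-- weight ≤ length + pairwise overlaps) turns this into |C|·w1 ≤ n, i.e.
-- |C| ≤ ⌊n/w1⌋, and into |C|·w ≤ n + C(|C|,2); the latter excludes 2·w2
-- codewords at length 2·w1·w2 + w2 − 1, where ⌊n/w1⌋ = 2·w2, so no smaller
-- threshold is admissible.  Conversely, for every n ≥ 2·w1·w2 + w2 a cyclic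
-- block construction yields ⌊n/w1⌋ codewords.

open import Defs
open import Data.Nat using (ℕ; zero; suc; _+_; _*_; _∸_; _≤_; _<_; z≤n; s≤s; z<s; s≤s⁻¹;
                            NonZero; _≟_; _≤?_; _<?_)
open import Data.Nat.Properties
open import Data.Nat.Divisibility using (n∣m*n)
open import Data.Nat.DivMod using (_/_; _%_; m*n/n≡m; /-monoˡ-≤; m<n⇒m/n≡0; +-distrib-/-∣ˡ;
                                   m≡m%n+[m/n]*n; m%n<n)
open import Data.Nat.ListAction using (sum)
open import Data.Nat.Tactic.RingSolver using (solve-∀)
open import Algebra.Properties.CommutativeSemigroup +-commutativeSemigroup using (interchange; xy∙z≈xz∙y)
open import Data.Fin using (Fin) renaming (_≟_ to _≟ᶠ_)
open import Data.Fin.Patterns using (0F; 1F; 2F)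
open import Data.Vec using (Vec; []; _∷_; _++_; head; tail; concat)
open import Data.List using (List; []; _∷_; length; map; applyUpTo)
open import Data.List.Properties using (length-applyUpTo)
open import Data.List.Membership.Propositional using (_∈_)
open import Data.List.Membership.Propositional.Properties using (∈-applyUpTo⁻)
open import Data.List.Relation.Unary.Any using (here; there)
import Data.List.Relation.Unary.All as All
open All using (All; []; _∷_)
open import Data.List.Relation.Unary.All.Properties using (applyUpTo⁺₁)
import Data.List.Relation.Unary.AllPairs as AllPairs
open AllPairs using (AllPairs; []; _∷_)
import Data.List.Relation.Unary.Unique.Propositional.Properties as Unique
open import Data.Product using (Σ; ∃; _×_; _,_; proj₁; proj₂)
open import Data.Sum using (_⊎_; inj₁; inj₂)
open import Data.Empty using (⊥; ⊥-elim)
open import Relation.Nullary using (¬_; yes; no)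
open import Relation.Binary.PropositionalEquality

private
  variable
    n : ℕ

-- Composition, support size, Hamming distance and the
-- various overlaps of two words are all sums of this shape.

LetterWeight : Set
LetterWeight = Fin 3 → ℕ

PairWeight : Set
PairWeight = Fin 3 → Fin 3 → ℕ

letterSum : LetterWeight → Word n → ℕ
letterSum h [] = 0
letterSum h (a ∷ x) = h a + letterSum h x

pairSum : PairWeight → Word n → Word n → ℕ
pairSum φ [] [] = 0
pairSum φ (a ∷ x) (b ∷ y) = φ a b + pairSum φ x y

indicator : Fin 3 → LetterWeight
indicator c a with a ≟ᶠ c
... | yes _ = 1
... | no _ = 0

disagree : PairWeight
disagree a b with a ≟ᶠ b
... | yes _ = 0
... | no _ = 1

inSupport : LetterWeight
inSupport a = indicator 1F a + indicator 2F a

isOne : LetterWeight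
isOne = indicator 1F

_⊗_ : LetterWeight → LetterWeight → PairWeight
(h ⊗ g) a b = h a * g b

supportOverlap : Word n → Word n → ℕ
supportOverlap = pairSum (inSupport ⊗ inSupport)

onesOverlap : Word n → Word n → ℕ
onesOverlap = pairSum (isOne ⊗ isOne)

count-as-sum : ∀ c (x : Word n) → count c x ≡ letterSum (indicator c) x
count-as-sum c [] = refl
count-as-sum c (a ∷ x) with a ≟ᶠ c
... | yes _ = cong suc (count-as-sum c x)
... | no _ = count-as-sum c x

hamming-as-sum : (x y : Word n) → hamming x y ≡ pairSum disagree x y
hamming-as-sum [] [] = refl
hamming-as-sum (a ∷ x) (b ∷ y) with a ≟ᶠ b
... | yes _ = hamming-as-sum x y
... | no _ = cong suc (hamming-as-sum x y)

hamming-self : (x : Word n) → hamming x x ≡ 0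
hamming-self [] = refl
hamming-self (a ∷ x) with a ≟ᶠ a
... | yes _ = hamming-self x
... | no a≢a = ⊥-elim (a≢a refl)

letterSum-+ : ∀ (h g : LetterWeight) (x : Word n) →
  letterSum (λ a → h a + g a) x ≡ letterSum h x + letterSum g x
letterSum-+ h g [] = refl
letterSum-+ h g (a ∷ x) =
  trans (cong (h a + g a +_) (letterSum-+ h g x)) (interchange (h a) (g a) _ _)

pairSum-+ : ∀ (φ ψ : PairWeight) (x y : Word n) →
  pairSum (λ a b → φ a b + ψ a b) x y ≡ pairSum φ x y + pairSum ψ x y
pairSum-+ φ ψ [] [] = refl
pairSum-+ φ ψ (a ∷ x) (b ∷ y) =
  trans (cong (φ a b + ψ a b +_) (pairSum-+ φ ψ x y)) (interchange (φ a b) (ψ a b) _ _)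

pairSum-mono : ∀ {φ ψ : PairWeight} → (∀ a b → φ a b ≤ ψ a b) →
  (x y : Word n) → pairSum φ x y ≤ pairSum ψ x y
pairSum-mono φ≤ψ [] [] = z≤n
pairSum-mono φ≤ψ (a ∷ x) (b ∷ y) = +-mono-≤ (φ≤ψ a b) (pairSum-mono φ≤ψ x y)

letterSum-pair : ∀ (h g : LetterWeight) (x y : Word n) →
  letterSum h x + letterSum g y ≡ pairSum (λ a b → h a + g b) x y
letterSum-pair h g [] [] = refl
letterSum-pair h g (a ∷ x) (b ∷ y) =
  trans (interchange (h a) _ (g b) _) (cong (h a + g b +_) (letterSum-pair h g x y))

supportSize : ∀ {w1 w2} (x : Word n) → HasComposition w1 w2 x →
  letterSum inSupport x ≡ w1 + w2
supportSize x (ones , twos) = trans (letterSum-+ (indicator 1F) (indicator 2F) x)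
  (cong₂ _+_ (trans (sym (count-as-sum 1F x)) ones) (trans (sym (count-as-sum 2F x)) twos))

onesSize : ∀ {w1 w2} (x : Word n) → HasComposition w1 w2 x → letterSum isOne x ≡ w1
onesSize x (ones , _) = trans (sym (count-as-sum 1F x)) ones

-- Per coordinate, a disagreement, a common nonzero letter and a common 1 cost
-- together at most the number of nonzero letters present; summing gives
--   d(x,y) + |supp x ∩ supp y| + #{k : x_k = y_k = 1} ≤ |supp x| + |supp y|.

overlapCost : ∀ a b → disagree a b + (inSupport ⊗ inSupport) a b + (isOne ⊗ isOne) a b
                      ≤ inSupport a + inSupport b
overlapCost 0F 0F = z≤n
overlapCost 0F 1F = s≤s z≤n
overlapCost 0F 2F = s≤s z≤n
overlapCost 1F 0F = s≤s z≤n
overlapCost 1F 1F = s≤s (s≤s z≤n)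
overlapCost 1F 2F = s≤s (s≤s z≤n)
overlapCost 2F 0F = s≤s z≤n
overlapCost 2F 1F = s≤s (s≤s z≤n)
overlapCost 2F 2F = s≤s z≤n

distance+overlaps : (x y : Word n) →
  hamming x y + supportOverlap x y + onesOverlap x y
    ≤ letterSum inSupport x + letterSum inSupport y
distance+overlaps x y = begin
  hamming x y + supportOverlap x y + onesOverlap x y
    ≡⟨ cong (λ d → d + supportOverlap x y + onesOverlap x y) (hamming-as-sum x y) ⟩
  pairSum disagree x y + supportOverlap x y + onesOverlap x y
    ≡⟨ cong (_+ onesOverlap x y) (sym (pairSum-+ disagree (inSupport ⊗ inSupport) x y)) ⟩
  pairSum (λ a b → disagree a b + (inSupport ⊗ inSupport) a b) x y + onesOverlap x y
    ≡⟨ sym (pairSum-+ _ (isOne ⊗ isOne) x y) ⟩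
  pairSum (λ a b → disagree a b + (inSupport ⊗ inSupport) a b + (isOne ⊗ isOne) a b) x y
    ≤⟨ pairSum-mono overlapCost x y ⟩
  pairSum (λ a b → inSupport a + inSupport b) x y
    ≡⟨ sym (letterSum-pair inSupport inSupport x y) ⟩
  letterSum inSupport x + letterSum inSupport y ∎
  where open ≤-Reasoning

onesOverlap≤supportOverlap : (x y : Word n) → onesOverlap x y ≤ supportOverlap x y
onesOverlap≤supportOverlap = pairSum-mono ones≤support
  where
  ones≤support : ∀ a b → (isOne ⊗ isOne) a b ≤ (inSupport ⊗ inSupport) a b
  ones≤support 0F b = z≤n
  ones≤support 1F 0F = z≤n
  ones≤support 1F 1F = s≤s z≤n
  ones≤support 1F 2F = z≤n
  ones≤support 2F b = z≤n

-- Both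
-- follow from the inequality above, since the two overlaps cost at most 1 and
-- a common 1 is also a common support coordinate.
Separated : Word n → Word n → Set
Separated x y = (supportOverlap x y ≤ 1) × (onesOverlap x y ≤ 0)

separated : ∀ {w1 w2} (x y : Word n) → HasComposition w1 w2 x → HasComposition w1 w2 y →
  2 * (w1 + w2) ∸ 1 ≤ hamming x y → Separated x y
separated {w1 = w1} {w2} x y cx cy far = overlap≤1 , ones≤0
  where
  w = w1 + w2
  O = supportOverlap x y
  O₁ = onesOverlap x y
  budget : hamming x y + (O + O₁) ≤ 1 + (2 * w ∸ 1)
  budget = begin
    hamming x y + (O + O₁)                         ≡⟨ sym (+-assoc (hamming x y) O O₁) ⟩
    hamming x y + O + O₁                           ≤⟨ distance+overlaps x y ⟩
    letterSum inSupport x + letterSum inSupport y  ≡⟨ cong₂ _+_ (supportSize x cx) (supportSize y cy) ⟩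
    w + w                                          ≡⟨ cong (w +_) (sym (+-identityʳ w)) ⟩
    2 * w                                          ≤⟨ m≤n+m∸n (2 * w) 1 ⟩
    1 + (2 * w ∸ 1)                                ∎
    where open ≤-Reasoning
  both≤1 : O + O₁ ≤ 1
  both≤1 = +-cancelʳ-≤ (2 * w ∸ 1) (O + O₁) 1
    (≤-trans (+-monoʳ-≤ (O + O₁) far)
    (≤-trans (≤-reflexive (+-comm (O + O₁) (hamming x y))) budget))
  overlap≤1 : O ≤ 1
  overlap≤1 = ≤-trans (m≤m+n O O₁) both≤1
  ones≤0 : O₁ ≤ 0
  ones≤0 = double≤1 O₁ (≤-trans (+-monoˡ-≤ O₁ (onesOverlap≤supportOverlap x y)) both≤1)
    where
    double≤1 : ∀ k → k + k ≤ 1 → k ≤ 0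
    double≤1 zero _ = z≤n
    double≤1 (suc k) (s≤s k+1+k≤0) with subst (_≤ 0) (+-suc k k) k+1+k≤0
    ... | ()

-- Conversely, the distance is at least |supp x| + |supp y| minus a per-coordinate
-- loss, which is 0 unless both letters are nonzero (then 2 if equal, 1 if not).
distanceLoss : PairWeight
distanceLoss a b = inSupport a + inSupport b ∸ disagree a b

supports≤distance+loss : (x y : Word n) →
  letterSum inSupport x + letterSum inSupport y ≤ hamming x y + pairSum distanceLoss x y
supports≤distance+loss x y = begin
  letterSum inSupport x + letterSum inSupport y
    ≡⟨ letterSum-pair inSupport inSupport x y ⟩
  pairSum (λ a b → inSupport a + inSupport b) x y
    ≤⟨ pairSum-mono (λ a b → m≤n+m∸n (inSupport a + inSupport b) (disagree a b)) x y ⟩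
  pairSum (λ a b → disagree a b + distanceLoss a b) x y
    ≡⟨ pairSum-+ disagree distanceLoss x y ⟩
  pairSum disagree x y + pairSum distanceLoss x y
    ≡⟨ cong (_+ pairSum distanceLoss x y) (sym (hamming-as-sum x y)) ⟩
  hamming x y + pairSum distanceLoss x y ∎
  where open ≤-Reasoning

-- The total weight of the words is bounded by
-- the number of coordinates plus the sum of pairwise overlaps (a Bonferroni
-- inequality), which is how the overlap bounds turn into bounds on code size.

totalWeight : LetterWeight → List (Word n) → ℕ
totalWeight h L = sum (map (letterSum h) L)

pairwiseSum : PairWeight → List (Word n) → ℕ
pairwiseSum φ [] = 0
pairwiseSum φ (x ∷ L) = sum (map (pairSum φ x) L) + pairwiseSum φ L

pairProducts : List ℕ → ℕ
pairProducts [] = 0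
pairProducts (b ∷ bs) = b * sum bs + pairProducts bs

bits-bonferroni : (bs : List ℕ) → All (_≤ 1) bs → sum bs ≤ 1 + pairProducts bs
bits-bonferroni [] [] = z≤n
bits-bonferroni (.0 ∷ bs) (z≤n ∷ bs≤1) = bits-bonferroni bs bs≤1
bits-bonferroni (.1 ∷ bs) (s≤s z≤n ∷ _) =
  s≤s (≤-trans (m≤m+n (sum bs) (pairProducts bs))
               (≤-reflexive (cong (_+ pairProducts bs) (sym (*-identityˡ (sum bs))))))

firstColumn : LetterWeight → List (Word (suc n)) → List ℕ
firstColumn h = map (λ x → h (head x))

otherColumns : List (Word (suc n)) → List (Word n)
otherColumns = map tail

totalWeight-split : ∀ h (L : List (Word (suc n))) →
  totalWeight h L ≡ sum (firstColumn h L) + totalWeight h (otherColumns L)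
totalWeight-split h [] = refl
totalWeight-split h ((a ∷ x) ∷ L) =
  trans (cong (h a + letterSum h x +_) (totalWeight-split h L)) (interchange (h a) _ _ _)

pairwiseSum-split : ∀ h (L : List (Word (suc n))) →
  pairwiseSum (h ⊗ h) L ≡ pairProducts (firstColumn h L) + pairwiseSum (h ⊗ h) (otherColumns L)
pairwiseSum-split h [] = refl
pairwiseSum-split h ((a ∷ x) ∷ L) =
  trans (cong₂ _+_ (rowSplit L) (pairwiseSum-split h L)) (interchange (h a * _) _ _ _)
  where
  rowSplit : ∀ L → sum (map (pairSum (h ⊗ h) (a ∷ x)) L)
                   ≡ h a * sum (firstColumn h L) + sum (map (pairSum (h ⊗ h) x) (otherColumns L))
  rowSplit [] = sym (cong (_+ 0) (*-zeroʳ (h a)))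
  rowSplit ((b ∷ y) ∷ L) = trans (cong (h a * h b + pairSum (h ⊗ h) x y +_) (rowSplit L)) (regroup (h a) (h b) _ _ _)
    where
    regroup : ∀ p q r s t → (p * q + r) + (p * s + t) ≡ p * (q + s) + (r + t)
    regroup = solve-∀

totalWeight-empty : ∀ h (L : List (Word 0)) → totalWeight h L ≡ 0
totalWeight-empty h [] = refl
totalWeight-empty h ([] ∷ L) = totalWeight-empty h L

bonferroni : ∀ n (h : LetterWeight) → (∀ a → h a ≤ 1) → (L : List (Word n)) →
  totalWeight h L ≤ n + pairwiseSum (h ⊗ h) L
bonferroni zero h h≤1 L = ≤-trans (≤-reflexive (totalWeight-empty h L)) z≤n
bonferroni (suc n) h h≤1 L = begin
  totalWeight h L
    ≡⟨ totalWeight-split h L ⟩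
  sum (firstColumn h L) + totalWeight h (otherColumns L)
    ≤⟨ +-mono-≤ (bits-bonferroni (firstColumn h L) (columnBits L)) (bonferroni n h h≤1 (otherColumns L)) ⟩
  (1 + pairProducts (firstColumn h L)) + (n + pairwiseSum (h ⊗ h) (otherColumns L))
    ≡⟨ interchange 1 (pairProducts (firstColumn h L)) n (pairwiseSum (h ⊗ h) (otherColumns L)) ⟩
  suc n + (pairProducts (firstColumn h L) + pairwiseSum (h ⊗ h) (otherColumns L))
    ≡⟨ cong (suc n +_) (sym (pairwiseSum-split h L)) ⟩
  suc n + pairwiseSum (h ⊗ h) L ∎
  where
  open ≤-Reasoning
  columnBits : (L : List (Word (suc n))) → All (_≤ 1) (firstColumn h L)
  columnBits [] = []
  columnBits (x ∷ L) = h≤1 (head x) ∷ columnBits L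

triangle : ℕ → ℕ
triangle zero = 0
triangle (suc k) = k + triangle k

sum-map-const : ∀ {A : Set} {k} (f : A → ℕ) {L : List A} → All (λ x → f x ≡ k) L →
  sum (map f L) ≡ length L * k
sum-map-const f [] = refl
sum-map-const f (fx≡k ∷ rest) = cong₂ _+_ fx≡k (sum-map-const f rest)

sum-map-≤ : ∀ {A : Set} {c} (f : A → ℕ) {L : List A} → All (λ x → f x ≤ c) L →
  sum (map f L) ≤ length L * c
sum-map-≤ f [] = z≤n
sum-map-≤ f (fx≤c ∷ rest) = +-mono-≤ fx≤c (sum-map-≤ f rest)

pairwiseSum-≤ : ∀ {φ : PairWeight} {c} {L : List (Word n)} →
  AllPairs (λ x y → pairSum φ x y ≤ c) L → pairwiseSum φ L ≤ triangle (length L) * c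
pairwiseSum-≤ [] = z≤n
pairwiseSum-≤ {c = c} {x ∷ L} (row ∷ rest) =
  ≤-trans (+-mono-≤ (sum-map-≤ _ row) (pairwiseSum-≤ rest))
          (≤-reflexive (sym (*-distribʳ-+ c (length L) (triangle (length L)))))

allPairs-∈ : ∀ {A : Set} {R Q : A → A → Set} {L : List A} → AllPairs R L →
  (∀ {x y} → x ∈ L → y ∈ L → R x y → Q x y) → AllPairs Q L
allPairs-∈ [] f = []
allPairs-∈ (r ∷ rs) f =
  All.tabulate (λ y∈L → f (here refl) (there y∈L) (All.lookup r y∈L))
  ∷ allPairs-∈ rs (λ x∈L y∈L → f (there x∈L) (there y∈L))

module _ {n w1 w2 : ℕ} (C : CCCode n (2 * (w1 + w2) ∸ 1) w1 w2) where
  open CCCode C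

  codewordsSeparated : AllPairs Separated words
  codewordsSeparated = allPairs-∈ distinct λ {x} {y} x∈C y∈C x≢y →
    separated {w1 = w1} {w2} x y (All.lookup composition x∈C) (All.lookup composition y∈C)
              (minDist x∈C y∈C x≢y)

  -- the 1-positions of distinct codewords are disjoint
  onesPacking : size C * w1 ≤ n
  onesPacking = begin
    size C * w1
      ≡⟨ sym (sum-map-const (letterSum isOne) (All.map (λ {x} → onesSize {w1 = w1} {w2} x) composition)) ⟩
    totalWeight isOne words
      ≤⟨ bonferroni n isOne isOne≤1 words ⟩
    n + pairwiseSum (isOne ⊗ isOne) words
      ≤⟨ +-monoʳ-≤ n (pairwiseSum-≤ (AllPairs.map proj₂ codewordsSeparated)) ⟩
    n + triangle (size C) * 0
      ≡⟨ trans (cong (n +_) (*-zeroʳ (triangle (size C)))) (+-identityʳ n) ⟩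
    n ∎
    where
    open ≤-Reasoning
    isOne≤1 : ∀ a → isOne a ≤ 1
    isOne≤1 0F = z≤n
    isOne≤1 1F = s≤s z≤n
    isOne≤1 2F = z≤n

  -- the supports of distinct codewords meet at most once
  supportPacking : size C * (w1 + w2) ≤ n + triangle (size C) * 1
  supportPacking = begin
    size C * (w1 + w2)
      ≡⟨ sym (sum-map-const (letterSum inSupport) (All.map (λ {x} → supportSize {w1 = w1} {w2} x) composition)) ⟩
    totalWeight inSupport words
      ≤⟨ bonferroni n inSupport inSupport≤1 words ⟩
    n + pairwiseSum (inSupport ⊗ inSupport) words
      ≤⟨ +-monoʳ-≤ n (pairwiseSum-≤ (AllPairs.map proj₁ codewordsSeparated)) ⟩
    n + triangle (size C) * 1 ∎
    where
    open ≤-Reasoning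
    inSupport≤1 : ∀ a → inSupport a ≤ 1
    inSupport≤1 0F = z≤n
    inSupport≤1 1F = s≤s z≤n
    inSupport≤1 2F = s≤s z≤n

  codeSize≤ : .{{_ : NonZero w1}} → size C ≤ n / w1
  codeSize≤ = ≤-trans (≤-reflexive (sym (m*n/n≡m (size C) w1))) (/-monoˡ-≤ w1 onesPacking)

-- At length 2·w1·w2 + w2 − 1 the value ⌊n/w1⌋ is
-- 2·w2, but 2·w2 codewords whose supports (of size w = w1 + w2) pairwise meet
-- at most once need length at least 2·w2·w − C(2·w2, 2) = 2·w1·w2 + w2.

triangle-double : ∀ m → 2 * triangle m + m ≡ m * m
triangle-double zero = refl
triangle-double (suc m) = begin
  2 * (m + triangle m) + suc m        ≡⟨ regroup m (triangle m) ⟩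
  (2 * triangle m + m) + suc (2 * m)  ≡⟨ cong (_+ suc (2 * m)) (triangle-double m) ⟩
  m * m + suc (2 * m)                 ≡⟨ square-suc m ⟩
  suc m * suc m                       ∎
  where
  open ≡-Reasoning
  regroup : ∀ m t → 2 * (m + t) + suc m ≡ (2 * t + m) + suc (2 * m)
  regroup = solve-∀
  square-suc : ∀ m → m * m + suc (2 * m) ≡ suc m * suc m
  square-suc = solve-∀

-- (stated for w2 = suc k, so that the length 2·w1·w2 + w2 − 1 needs no ∸)
noCodeBelowThreshold : ∀ w1 k (C : CCCode (2 * w1 * suc k + k) (2 * (w1 + suc k) ∸ 1) w1 (suc k)) →
  size C ≢ 2 * suc k
noCodeBelowThreshold w1 k C size≡m = 1+n≰n (≤-trans (s≤s (n≤1+n _)) tooLong)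
  where
  len = 2 * w1 * suc k + k
  m = 2 * suc k
  packing : m * (w1 + suc k) ≤ len + triangle m * 1
  packing = subst (λ s → s * (w1 + suc k) ≤ len + triangle s * 1) size≡m (supportPacking C)
  excess : 2 * (m * (w1 + suc k)) + m ≡ 2 + (2 * len + m * m)
  excess = identity w1 k
    where
    identity : ∀ w1 k → 2 * ((2 * suc k) * (w1 + suc k)) + 2 * suc k
                        ≡ 2 + (2 * (2 * w1 * suc k + k) + (2 * suc k) * (2 * suc k))
    identity = solve-∀
  tooLong : 2 + (2 * len + m * m) ≤ 2 * len + m * m
  tooLong = begin
    2 + (2 * len + m * m)           ≡⟨ sym excess ⟩
    2 * (m * (w1 + suc k)) + m      ≤⟨ +-monoˡ-≤ m (*-monoʳ-≤ 2 packing) ⟩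
    2 * (len + triangle m * 1) + m  ≡⟨ regroup len (triangle m) m ⟩
    2 * len + (2 * triangle m + m)  ≡⟨ cong (2 * len +_) (triangle-double m) ⟩
    2 * len + m * m                 ∎
    where
    open ≤-Reasoning
    regroup : ∀ a t c → 2 * (a + t * 1) + c ≡ 2 * a + (2 * t + c)
    regroup = solve-∀

∑ : ℕ → (ℕ → ℕ) → ℕ
∑ zero f = 0
∑ (suc k) f = f 0 + ∑ k (λ p → f (suc p))

∑-cong : ∀ k {f g : ℕ → ℕ} → (∀ p → p < k → f p ≡ g p) → ∑ k f ≡ ∑ k g
∑-cong zero f≡g = refl
∑-cong (suc k) f≡g = cong₂ _+_ (f≡g 0 z<s) (∑-cong k (λ p p<k → f≡g (suc p) (s≤s p<k)))

∑-mono : ∀ k {f g : ℕ → ℕ} → (∀ p → p < k → f p ≤ g p) → ∑ k f ≤ ∑ k g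
∑-mono zero f≤g = z≤n
∑-mono (suc k) f≤g = +-mono-≤ (f≤g 0 z<s) (∑-mono k (λ p p<k → f≤g (suc p) (s≤s p<k)))

∑-zero : ∀ k {f : ℕ → ℕ} → (∀ p → p < k → f p ≡ 0) → ∑ k f ≡ 0
∑-zero k f≡0 = trans (∑-cong k f≡0) (∑-of-zeros k)
  where
  ∑-of-zeros : ∀ k → ∑ k (λ _ → 0) ≡ 0
  ∑-of-zeros zero = refl
  ∑-of-zeros (suc k) = ∑-of-zeros k

∑-const : ∀ k c → ∑ k (λ _ → c) ≡ k * c
∑-const zero c = refl
∑-const (suc k) c = cong (c +_) (∑-const k c)

∑-+ : ∀ k (f g : ℕ → ℕ) → ∑ k (λ p → f p + g p) ≡ ∑ k f + ∑ k g
∑-+ zero f g = refl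
∑-+ (suc k) f g =
  trans (cong (f 0 + g 0 +_) (∑-+ k (λ p → f (suc p)) (λ p → g (suc p)))) (interchange (f 0) (g 0) _ _)

∑-swap : ∀ a b (g : ℕ → ℕ → ℕ) → ∑ a (λ j → ∑ b (g j)) ≡ ∑ b (λ o → ∑ a (λ j → g j o))
∑-swap zero b g = sym (∑-zero b (λ _ _ → refl))
∑-swap (suc a) b g = trans (cong (∑ b (g 0) +_) (∑-swap a b (λ j → g (suc j))))
                           (sym (∑-+ b (g 0) (λ o → ∑ a (λ j → g (suc j) o))))

∑-split : ∀ a b (g : ℕ → ℕ) → ∑ (a + b) g ≡ ∑ a g + ∑ b (λ p → g (a + p))
∑-split zero b g = refl
∑-split (suc a) b g = trans (cong (g 0 +_) (∑-split a b (λ p → g (suc p)))) (sym (+-assoc (g 0) _ _))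

∑-snoc : ∀ k (g : ℕ → ℕ) → ∑ (suc k) g ≡ ∑ k g + g k
∑-snoc k g = begin
  ∑ (suc k) g                 ≡⟨ cong (λ l → ∑ l g) (+-comm 1 k) ⟩
  ∑ (k + 1) g                 ≡⟨ ∑-split k 1 g ⟩
  ∑ k g + (g (k + 0) + 0)     ≡⟨ cong (λ t → ∑ k g + t) (trans (+-identityʳ _) (cong g (+-identityʳ k))) ⟩
  ∑ k g + g k                 ∎
  where open ≡-Reasoning

∑-truncate : ∀ a b (g : ℕ → ℕ) → b ≤ a → (∀ p → b ≤ p → g p ≡ 0) → ∑ a g ≡ ∑ b g
∑-truncate a b g b≤a vanish = begin
  ∑ a g                                ≡⟨ cong (λ l → ∑ l g) (sym (m+[n∸m]≡n b≤a)) ⟩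
  ∑ (b + (a ∸ b)) g                    ≡⟨ ∑-split b (a ∸ b) g ⟩
  ∑ b g + ∑ (a ∸ b) (λ p → g (b + p))  ≡⟨ cong (∑ b g +_) (∑-zero (a ∸ b) (λ p _ → vanish (b + p) (m≤m+n b p))) ⟩
  ∑ b g + 0                            ≡⟨ +-identityʳ _ ⟩
  ∑ b g                                ∎
  where open ≡-Reasoning

∑-pos : ∀ k (g : ℕ → ℕ) → 1 ≤ ∑ k g → ∃ λ p → 1 ≤ g p
∑-pos zero g ()
∑-pos (suc k) g positive with g 0 in g0
... | suc _ = 0 , ≤-trans (s≤s z≤n) (≤-reflexive (sym g0))
... | zero with ∑-pos k (λ p → g (suc p)) positive
...   | p , gp = suc p , gp

+-≤1 : ∀ {x y} → x ≤ 1 → y ≤ 1 → (1 ≤ x → 1 ≤ y → ⊥) → x + y ≤ 1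
+-≤1 {zero} _ y≤1 _ = y≤1
+-≤1 {suc x} {zero} x≤1 _ _ = ≤-trans (≤-reflexive (+-identityʳ (suc x))) x≤1
+-≤1 {suc x} {suc y} _ _ notBoth = ⊥-elim (notBoth (s≤s z≤n) (s≤s z≤n))

∑-atMostOne : ∀ k (g : ℕ → ℕ) → (∀ p → g p ≤ 1) → (∀ {p q} → 1 ≤ g p → 1 ≤ g q → p ≡ q) →
  ∑ k g ≤ 1
∑-atMostOne zero g g≤1 unique = z≤n
∑-atMostOne (suc k) g g≤1 unique =
  +-≤1 (g≤1 0) (∑-atMostOne k (λ p → g (suc p)) (λ p → g≤1 (suc p)) (λ gp gq → suc-injective (unique gp gq)))
       (λ g0 rest → let (p , gp) = ∑-pos k (λ p → g (suc p)) rest in 0≢1+n (unique g0 gp))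

δ : ℕ → ℕ → ℕ
δ zero zero = 1
δ zero (suc _) = 0
δ (suc _) zero = 0
δ (suc a) (suc b) = δ a b

δ-≤1 : ∀ a b → δ a b ≤ 1
δ-≤1 zero zero = s≤s z≤n
δ-≤1 zero (suc b) = z≤n
δ-≤1 (suc a) zero = z≤n
δ-≤1 (suc a) (suc b) = δ-≤1 a b

δ-refl : ∀ a → δ a a ≡ 1
δ-refl zero = refl
δ-refl (suc a) = δ-refl a

δ-≡ : ∀ {a b} → 1 ≤ δ a b → a ≡ b
δ-≡ {zero} {zero} _ = refl
δ-≡ {suc a} {suc b} pos = cong suc (δ-≡ pos)

δ-≢ : ∀ {a b} → a ≢ b → δ a b ≡ 0
δ-≢ {zero} {zero} a≢b = ⊥-elim (a≢b refl)
δ-≢ {zero} {suc b} _ = refl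
δ-≢ {suc a} {zero} _ = refl
δ-≢ {suc a} {suc b} a≢b = δ-≢ (λ a≡b → a≢b (cong suc a≡b))

∑-δ : ∀ k i (f : ℕ → ℕ) → i < k → ∑ k (λ j → δ j i * f j) ≡ f i
∑-δ (suc k) zero f _ = trans (cong₂ _+_ (+-identityʳ (f 0)) (∑-zero k (λ _ _ → refl))) (+-identityʳ (f 0))
∑-δ (suc k) (suc i) f (s≤s i<k) = ∑-δ k i (λ p → f (suc p)) i<k

∑-δ₁ : ∀ k i → i < k → ∑ k (λ j → δ j i) ≡ 1
∑-δ₁ k i i<k = trans (∑-cong k (λ j _ → sym (*-identityʳ (δ j i)))) (∑-δ k i (λ _ → 1) i<k)

-- Steps around the cycle 0, 1, …, M−1.  The relation i ⟶⟨ k ⟩ j says that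
-- k steps starting at i end at j, passing the point 0 at most once.
module Cycle (M : ℕ) where

  data _⟶⟨_⟩_ (i k j : ℕ) : Set where
    direct  : i + k ≡ j → i ⟶⟨ k ⟩ j
    wrapped : i + k ≡ j + M → i ⟶⟨ k ⟩ j

  _⊕_ : ℕ → ℕ → ℕ
  i ⊕ k with i + k <? M
  ... | yes _ = i + k
  ... | no _ = i + k ∸ M

  ⊕-step : ∀ i k → i ⟶⟨ k ⟩ (i ⊕ k)
  ⊕-step i k with i + k <? M
  ... | yes _ = direct refl
  ... | no i+k≮M = wrapped (sym (m∸n+n≡m (≮⇒≥ i+k≮M)))

  ⊕-< : ∀ {i k} → i < M → k ≤ M → i ⊕ k < M
  ⊕-< {i} {k} i<M k≤M with i + k <? M
  ... | yes i+k<M = i+k<M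
  ... | no i+k≮M = +-cancelʳ-< M (i + k ∸ M) M (begin-strict
    i + k ∸ M + M  ≡⟨ m∸n+n≡m (≮⇒≥ i+k≮M) ⟩
    i + k          <⟨ +-mono-<-≤ i<M k≤M ⟩
    M + M          ∎)
    where open ≤-Reasoning

  ⟶-source : ∀ {a b c j} → a < M → b < M → a ⟶⟨ c ⟩ j → b ⟶⟨ c ⟩ j → a ≡ b
  ⟶-source _ _ (direct e) (direct e') = +-cancelʳ-≡ _ _ _ (trans e (sym e'))
  ⟶-source _ _ (wrapped e) (wrapped e') = +-cancelʳ-≡ _ _ _ (trans e (sym e'))
  ⟶-source _ b<M (direct e) (wrapped e') = ⊥-elim (overshoot b<M e e')
    where
    overshoot : ∀ {a b c j} → b < M → a + c ≡ j → b + c ≡ j + M → ⊥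
    overshoot {a} {b} {c} b<M e e' = <⇒≱ b<M (begin
      M      ≤⟨ m≤n+m M a ⟩
      a + M  ≡⟨ +-cancelʳ-≡ c (a + M) b (trans (xy∙z≈xz∙y a M c) (trans (cong (_+ M) e) (sym e'))) ⟩
      b      ∎)
      where open ≤-Reasoning
  ⟶-source a<M b<M (wrapped e) (direct e') = sym (⟶-source b<M a<M (direct e') (wrapped e))

  ⟶-length : ∀ {i k k' j} → k < M → k' < M → i ⟶⟨ k ⟩ j → i ⟶⟨ k' ⟩ j → k ≡ k'
  ⟶-length k<M k'<M p q = ⟶-source k<M k'<M (swap p) (swap q)
    where
    swap : ∀ {i k j} → i ⟶⟨ k ⟩ j → k ⟶⟨ i ⟩ j
    swap {i} {k} (direct e) = direct (trans (+-comm k i) e)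
    swap {i} {k} (wrapped e) = wrapped (trans (+-comm k i) e)

  ⟶-roundTrip : ∀ {i j k k'} → i ⟶⟨ k ⟩ j → j ⟶⟨ k' ⟩ i → (k + k' ≡ 0) ⊎ (M ≤ k + k')
  ⟶-roundTrip {i} {j} {k} {k'} (direct e) (direct e') =
    inj₁ (+-cancelˡ-≡ i (k + k') 0 (trans around (trans e' (sym (+-identityʳ i)))))
    where
    around : i + (k + k') ≡ j + k'
    around = trans (sym (+-assoc i k k')) (cong (_+ k') e)
  ⟶-roundTrip {i} {j} {k} {k'} (direct e) (wrapped e') =
    inj₂ (≤-reflexive (sym (+-cancelˡ-≡ i (k + k') M (trans (sym (+-assoc i k k')) (trans (cong (_+ k') e) e')))))
  ⟶-roundTrip {i} {j} {k} {k'} (wrapped e) (direct e') =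
    inj₂ (≤-reflexive (sym (+-cancelˡ-≡ i (k + k') M (begin
      i + (k + k')   ≡⟨ sym (+-assoc i k k') ⟩
      i + k + k'     ≡⟨ cong (_+ k') e ⟩
      j + M + k'     ≡⟨ xy∙z≈xz∙y j M k' ⟩
      j + k' + M     ≡⟨ cong (_+ M) e' ⟩
      i + M          ∎))))
    where open ≡-Reasoning
  ⟶-roundTrip {i} {j} {k} {k'} (wrapped e) (wrapped e') =
    inj₂ (≤-trans (m≤m+n M M) (≤-reflexive (sym (+-cancelˡ-≡ i (k + k') (M + M) (begin
      i + (k + k')   ≡⟨ sym (+-assoc i k k') ⟩
      i + k + k'     ≡⟨ cong (_+ k') e ⟩
      j + M + k'     ≡⟨ xy∙z≈xz∙y j M k' ⟩
      j + k' + M     ≡⟨ cong (_+ M) e' ⟩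
      i + M + M      ≡⟨ +-assoc i M M ⟩
      i + (M + M)    ∎)))))
    where open ≡-Reasoning

tabulateℕ : ∀ {A : Set} k → (ℕ → A) → Vec A k
tabulateℕ zero f = []
tabulateℕ (suc k) f = f 0 ∷ tabulateℕ k (λ p → f (suc p))

pairSum-tabulate : ∀ k φ (f g : ℕ → Fin 3) →
  pairSum φ (tabulateℕ k f) (tabulateℕ k g) ≡ ∑ k (λ p → φ (f p) (g p))
pairSum-tabulate zero φ f g = refl
pairSum-tabulate (suc k) φ f g = cong (φ (f 0) (g 0) +_) (pairSum-tabulate k φ (λ p → f (suc p)) (λ p → g (suc p)))

pairSum-++ : ∀ {a b} φ (x y : Word a) (x' y' : Word b) →
  pairSum φ (x ++ x') (y ++ y') ≡ pairSum φ x y + pairSum φ x' y'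
pairSum-++ φ [] [] x' y' = refl
pairSum-++ φ (a ∷ x) (b ∷ y) x' y' =
  trans (cong (φ a b +_) (pairSum-++ φ x y x' y')) (sym (+-assoc (φ a b) _ _))

pairSum-concat : ∀ {w} m φ (F G : ℕ → Word w) →
  pairSum φ (concat (tabulateℕ m F)) (concat (tabulateℕ m G)) ≡ ∑ m (λ j → pairSum φ (F j) (G j))
pairSum-concat zero φ F G = refl
pairSum-concat (suc m) φ F G =
  trans (pairSum-++ φ (F 0) (G 0) _ _) (cong (pairSum φ (F 0) (G 0) +_) (pairSum-concat m φ (λ j → F (suc j)) (λ j → G (suc j))))

letterSum-diagonal : ∀ h (x : Word n) → letterSum h x ≡ pairSum (λ a _ → h a) x x
letterSum-diagonal h [] = refl
letterSum-diagonal h (a ∷ x) = cong (h a +_) (letterSum-diagonal h x)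

-- Split the m·w1 + r coordinates into m blocks of length w1
-- followed by a tail block (number m) of length r.  Codeword i < m fills block
-- i with ones and, for every offset o < w2, puts a two at offset o of block
-- i ⊕ (o+1) on a cycle of M blocks, where M = m, or M = m + 1 when the tail is
-- long enough (w2 ≤ r) to serve as an extra block for the twos.  The ones of
-- different codewords never meet, twos of different codewords never meet,
-- and since 2·w2 < M, codeword i has a two in block i' only if i' has none in
-- block i: the supports of two codewords meet at most once.
module Construction (w1 w2 m r M : ℕ) (w1≥1 : 1 ≤ w1) (w2≤w1 : w2 ≤ w1) (room : 2 * w2 < M)
                    (blockCount : (M ≡ m) ⊎ (M ≡ suc m × w2 ≤ r)) where
  open Cycle M

  m≤M : m ≤ M
  m≤M = fromBlockCount blockCount
    where
    fromBlockCount : (M ≡ m) ⊎ (M ≡ suc m × w2 ≤ r) → m ≤ M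
    fromBlockCount (inj₁ M≡m) = ≤-reflexive (sym M≡m)
    fromBlockCount (inj₂ (M≡m+1 , _)) = ≤-trans (n≤1+n m) (≤-reflexive (sym M≡m+1))

  steps<M : ∀ {o} → o < w2 → suc o < M
  steps<M o<w2 = ≤-<-trans (≤-trans o<w2 (m≤m+n w2 (w2 + 0))) room

  -- 1 iff codeword i has a two at offset o of block j
  twoAt : ℕ → ℕ → ℕ → ℕ
  twoAt i j o with o <? w2
  ... | yes _ = δ j (i ⊕ suc o)
  ... | no _ = 0

  twoAt-below : ∀ i j {o} → o < w2 → twoAt i j o ≡ δ j (i ⊕ suc o)
  twoAt-below i j {o} o<w2 with o <? w2
  ... | yes _ = refl
  ... | no o≮w2 = ⊥-elim (o≮w2 o<w2)

  twoAt-beyond : ∀ i j {o} → w2 ≤ o → twoAt i j o ≡ 0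
  twoAt-beyond i j {o} w2≤o with o <? w2
  ... | yes o<w2 = ⊥-elim (<⇒≱ o<w2 w2≤o)
  ... | no _ = refl

  twoAt-≤1 : ∀ i j o → twoAt i j o ≤ 1
  twoAt-≤1 i j o with o <? w2
  ... | yes _ = δ-≤1 j (i ⊕ suc o)
  ... | no _ = z≤n

  twoAt-step : ∀ {i j o} → 1 ≤ twoAt i j o → (o < w2) × (i ⟶⟨ suc o ⟩ j)
  twoAt-step {i} {j} {o} two with o <? w2
  ... | yes o<w2 = o<w2 , subst (i ⟶⟨ suc o ⟩_) (sym (δ-≡ two)) (⊕-step i (suc o))
  ... | no _ = ⊥-elim (1+n≰n two)

  twoAt-own : ∀ i o → twoAt i i o ≡ 0
  twoAt-own i o with twoAt i i o in t
  ... | zero = refl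
  ... | suc _ with twoAt-step {i} {i} {o} (subst (1 ≤_) (sym t) (s≤s z≤n))
  ...   | o<w2 , loop with ⟶-roundTrip loop (direct (+-identityʳ i))
  ...     | inj₁ ()
  ...     | inj₂ M≤o+1 = ⊥-elim (<⇒≱ (steps<M o<w2) (≤-trans M≤o+1 (≤-reflexive (+-identityʳ (suc o)))))

  entry : ℕ → ℕ → ℕ → Fin 3
  entry i j o with j ≟ i | twoAt i j o
  ... | yes _ | _ = 1F
  ... | no _ | zero = 0F
  ... | no _ | suc _ = 2F

  isOne-entry : ∀ i j o → isOne (entry i j o) ≡ δ j i
  isOne-entry i j o with j ≟ i | twoAt i j o
  ... | yes refl | _ = sym (δ-refl i)
  ... | no j≢i | zero = sym (δ-≢ j≢i)
  ... | no j≢i | suc _ = sym (δ-≢ j≢i)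

  isTwo-entry : ∀ i j o → indicator 2F (entry i j o) ≡ twoAt i j o
  isTwo-entry i j o with j ≟ i | twoAt i j o in t
  ... | yes refl | _ = trans (sym (twoAt-own i o)) t
  ... | no _ | zero = refl
  ... | no _ | suc zero = refl
  ... | no _ | suc (suc _) with subst (_≤ 1) t (twoAt-≤1 i j o)
  ...   | s≤s ()

  loss-entry : ∀ {i i'} j o → i < M → i' < M → i ≢ i' →
    distanceLoss (entry i j o) (entry i' j o) ≤ δ j i * twoAt i' j o + δ j i' * twoAt i j o
  loss-entry {i} {i'} j o i<M i'<M i≢i' with j ≟ i | j ≟ i' | twoAt i j o in t | twoAt i' j o in t'
  ... | yes refl | yes refl | _ | _ = ⊥-elim (i≢i' refl)
  ... | yes refl | no _ | _ | zero = z≤n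
  ... | yes refl | no _ | _ | suc _ rewrite δ-refl i = s≤s z≤n
  ... | no _ | yes refl | zero | _ = z≤n
  ... | no _ | yes refl | suc _ | _ rewrite δ-refl i' = ≤-trans (s≤s z≤n) (m≤n+m _ _)
  ... | no _ | no _ | zero | zero = z≤n
  ... | no _ | no _ | zero | suc _ = z≤n
  ... | no _ | no _ | suc _ | zero = z≤n
  ... | no _ | no _ | suc _ | suc _ = ⊥-elim (i≢i' (⟶-source i<M i'<M (proj₂ (twoAt-step two)) (proj₂ (twoAt-step two'))))
    where
    two : 1 ≤ twoAt i j o
    two = subst (1 ≤_) (sym t) (s≤s z≤n)
    two' : 1 ≤ twoAt i' j o
    two' = subst (1 ≤_) (sym t') (s≤s z≤n)

  codeword : ℕ → Word (m * w1 + r)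
  codeword i = concat (tabulateℕ m (λ j → tabulateℕ w1 (entry i j))) ++ tabulateℕ r (entry i m)

  pairSum-codewords : ∀ φ i i' → pairSum φ (codeword i) (codeword i')
    ≡ ∑ m (λ j → ∑ w1 (λ o → φ (entry i j o) (entry i' j o))) + ∑ r (λ o → φ (entry i m o) (entry i' m o))
  pairSum-codewords φ i i' = trans
    (pairSum-++ φ (concat (tabulateℕ m (λ j → tabulateℕ w1 (entry i j)))) (concat (tabulateℕ m (λ j → tabulateℕ w1 (entry i' j))))
                  (tabulateℕ r (entry i m)) (tabulateℕ r (entry i' m)))
    (cong₂ _+_ (trans (pairSum-concat m φ (λ j → tabulateℕ w1 (entry i j)) (λ j → tabulateℕ w1 (entry i' j)))
                      (∑-cong m (λ j _ → pairSum-tabulate w1 φ (entry i j) (entry i' j))))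
               (pairSum-tabulate r φ (entry i m) (entry i' m)))

  letterSum-codeword : ∀ h i → letterSum h (codeword i)
    ≡ ∑ m (λ j → ∑ w1 (λ o → h (entry i j o))) + ∑ r (λ o → h (entry i m o))
  letterSum-codeword h i = trans (letterSum-diagonal h (codeword i)) (pairSum-codewords (λ a _ → h a) i i)

  m≢ : ∀ {i} → i < m → m ≢ i
  m≢ i<m m≡i = <-irrefl (sym m≡i) i<m

  ones-codeword : ∀ {i} → i < m → count 1F (codeword i) ≡ w1
  ones-codeword {i} i<m = begin
    count 1F (codeword i)
      ≡⟨ trans (count-as-sum 1F (codeword i)) (letterSum-codeword isOne i) ⟩
    ∑ m (λ j → ∑ w1 (λ o → isOne (entry i j o))) + ∑ r (λ o → isOne (entry i m o))
      ≡⟨ cong₂ _+_ (∑-cong m (λ j _ → ∑-cong w1 (λ o _ → isOne-entry i j o)))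
                   (∑-zero r (λ o _ → trans (isOne-entry i m o) (δ-≢ (m≢ i<m)))) ⟩
    ∑ m (λ j → ∑ w1 (λ _ → δ j i)) + 0
      ≡⟨ +-identityʳ _ ⟩
    ∑ m (λ j → ∑ w1 (λ _ → δ j i))
      ≡⟨ ∑-cong m (λ j _ → trans (∑-const w1 (δ j i)) (*-comm w1 (δ j i))) ⟩
    ∑ m (λ j → δ j i * w1)
      ≡⟨ ∑-δ m i (λ _ → w1) i<m ⟩
    w1 ∎
    where open ≡-Reasoning

  landing<M : ∀ {i o} → i < m → o < w2 → i ⊕ suc o < M
  landing<M i<m o<w2 = ⊕-< (≤-trans i<m m≤M) (<⇒≤ (steps<M o<w2))

  twoLands : ∀ {i o} → i < m → o < w2 → ∑ m (λ j → twoAt i j o) + twoAt i m o ≡ 1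
  twoLands {i} {o} i<m o<w2 =
    trans (cong₂ _+_ (∑-cong m (λ j _ → twoAt-below i j o<w2)) (twoAt-below i m o<w2)) (lands blockCount)
    where
    s = i ⊕ suc o
    lands : (M ≡ m) ⊎ (M ≡ suc m × w2 ≤ r) → ∑ m (λ j → δ j s) + δ m s ≡ 1
    lands (inj₁ M≡m) = cong₂ _+_ (∑-δ₁ m s s<m) (δ-≢ (λ m≡s → <-irrefl (sym m≡s) s<m))
      where
      s<m : s < m
      s<m = subst (s <_) M≡m (landing<M i<m o<w2)
    lands (inj₂ (M≡m+1 , _)) =
      trans (sym (∑-snoc m (λ j → δ j s))) (∑-δ₁ (suc m) s (subst (s <_) M≡m+1 (landing<M i<m o<w2)))

  tailTwos : ∀ {i} → i < m → ∑ r (twoAt i m) ≡ ∑ w2 (twoAt i m)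
  tailTwos {i} i<m = fromBlockCount blockCount
    where
    fromBlockCount : (M ≡ m) ⊎ (M ≡ suc m × w2 ≤ r) → ∑ r (twoAt i m) ≡ ∑ w2 (twoAt i m)
    fromBlockCount (inj₁ M≡m) = trans (∑-zero r (λ o _ → noTail o)) (sym (∑-zero w2 (λ o _ → noTail o)))
      where
      noTail : ∀ o → twoAt i m o ≡ 0
      noTail o with <-≤-connex o w2
      ... | inj₁ o<w2 = trans (twoAt-below i m o<w2)
                             (δ-≢ (λ m≡s → <-irrefl (sym m≡s) (subst (_ <_) M≡m (landing<M i<m o<w2))))
      ... | inj₂ w2≤o = twoAt-beyond i m w2≤o
    fromBlockCount (inj₂ (_ , w2≤r)) = ∑-truncate r w2 (twoAt i m) w2≤r (λ o → twoAt-beyond i m)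

  twos-codeword : ∀ {i} → i < m → count 2F (codeword i) ≡ w2
  twos-codeword {i} i<m = begin
    count 2F (codeword i)
      ≡⟨ trans (count-as-sum 2F (codeword i)) (letterSum-codeword (indicator 2F) i) ⟩
    ∑ m (λ j → ∑ w1 (λ o → indicator 2F (entry i j o))) + ∑ r (λ o → indicator 2F (entry i m o))
      ≡⟨ cong₂ _+_ (∑-cong m (λ j _ → ∑-cong w1 (λ o _ → isTwo-entry i j o))) (∑-cong r (λ o _ → isTwo-entry i m o)) ⟩
    ∑ m (λ j → ∑ w1 (twoAt i j)) + ∑ r (twoAt i m)
      ≡⟨ cong₂ _+_ (∑-swap m w1 (twoAt i)) (tailTwos i<m) ⟩
    ∑ w1 (λ o → ∑ m (λ j → twoAt i j o)) + ∑ w2 (twoAt i m)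
      ≡⟨ cong (_+ ∑ w2 (twoAt i m))
              (∑-truncate w1 w2 _ w2≤w1 (λ o w2≤o → ∑-zero m (λ j _ → twoAt-beyond i j w2≤o))) ⟩
    ∑ w2 (λ o → ∑ m (λ j → twoAt i j o)) + ∑ w2 (twoAt i m)
      ≡⟨ sym (∑-+ w2 (λ o → ∑ m (λ j → twoAt i j o)) (twoAt i m)) ⟩
    ∑ w2 (λ o → ∑ m (λ j → twoAt i j o) + twoAt i m o)
      ≡⟨ ∑-cong w2 (λ o o<w2 → twoLands i<m o<w2) ⟩
    ∑ w2 (λ _ → 1)
      ≡⟨ trans (∑-const w2 1) (*-identityʳ w2) ⟩
    w2 ∎
    where open ≡-Reasoning

  composition-codeword : ∀ {i} → i < m → HasComposition w1 w2 (codeword i)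
  composition-codeword i<m = ones-codeword i<m , twos-codeword i<m

  twosInBlock : ∀ i' i → ∑ w1 (twoAt i' i) ≤ 1
  twosInBlock i' i = ∑-atMostOne w1 (twoAt i' i) (twoAt-≤1 i' i) sameOffset
    where
    sameOffset : ∀ {p q} → 1 ≤ twoAt i' i p → 1 ≤ twoAt i' i q → p ≡ q
    sameOffset tp tq with twoAt-step tp | twoAt-step tq
    ... | p<w2 , p-steps | q<w2 , q-steps =
      suc-injective (⟶-length (steps<M p<w2) (steps<M q<w2) p-steps q-steps)

  notMutual : ∀ i i' → 1 ≤ ∑ w1 (twoAt i' i) → 1 ≤ ∑ w1 (twoAt i i') → ⊥
  notMutual i i' toward back with ∑-pos w1 (twoAt i' i) toward | ∑-pos w1 (twoAt i i') back
  ... | p , tp | q , tq with twoAt-step tp | twoAt-step tq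
  ...   | p<w2 , i'→i | q<w2 , i→i' with ⟶-roundTrip i'→i i→i'
  ...     | inj₁ ()
  ...     | inj₂ fullTurn =
    <⇒≱ room (≤-trans fullTurn (+-mono-≤ p<w2 (≤-trans q<w2 (≤-reflexive (sym (+-identityʳ w2))))))

  loss-codewords : ∀ {i i'} → i < m → i' < m → i ≢ i' →
    pairSum distanceLoss (codeword i) (codeword i') ≤ 1
  loss-codewords {i} {i'} i<m i'<m i≢i' = begin
    pairSum distanceLoss (codeword i) (codeword i')
      ≡⟨ pairSum-codewords distanceLoss i i' ⟩
    ∑ m (λ j → ∑ w1 (λ o → distanceLoss (entry i j o) (entry i' j o)))
      + ∑ r (λ o → distanceLoss (entry i m o) (entry i' m o))
      ≤⟨ +-mono-≤ (∑-mono m (λ j _ → ∑-mono w1 (λ o _ → bound j o))) tailLoss ⟩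
    ∑ m (λ j → ∑ w1 (λ o → A j o + B j o)) + 0
      ≡⟨ +-identityʳ _ ⟩
    ∑ m (λ j → ∑ w1 (λ o → A j o + B j o))
      ≡⟨ ∑-swap m w1 (λ j o → A j o + B j o) ⟩
    ∑ w1 (λ o → ∑ m (λ j → A j o + B j o))
      ≡⟨ ∑-cong w1 (λ o _ → trans (∑-+ m (λ j → A j o) (λ j → B j o))
           (cong₂ _+_ (∑-δ m i (λ j → twoAt i' j o) i<m) (∑-δ m i' (λ j → twoAt i j o) i'<m))) ⟩
    ∑ w1 (λ o → twoAt i' i o + twoAt i i' o)
      ≡⟨ ∑-+ w1 (twoAt i' i) (twoAt i i') ⟩
    ∑ w1 (twoAt i' i) + ∑ w1 (twoAt i i')
      ≤⟨ +-≤1 (twosInBlock i' i) (twosInBlock i i') (notMutual i i') ⟩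
    1 ∎
    where
    open ≤-Reasoning
    A B : ℕ → ℕ → ℕ
    A j o = δ j i * twoAt i' j o
    B j o = δ j i' * twoAt i j o
    bound : ∀ j o → distanceLoss (entry i j o) (entry i' j o) ≤ A j o + B j o
    bound j o = loss-entry j o (≤-trans i<m m≤M) (≤-trans i'<m m≤M) i≢i'
    tailLoss : ∑ r (λ o → distanceLoss (entry i m o) (entry i' m o)) ≤ 0
    tailLoss = ≤-trans
      (∑-mono r (λ o _ → ≤-trans (bound m o)
        (≤-reflexive (cong₂ (λ a b → a * twoAt i' m o + b * twoAt i m o) (δ-≢ (m≢ i<m)) (δ-≢ (m≢ i'<m))))))
      (≤-reflexive (∑-zero r (λ _ _ → refl)))

  distance-codewords : ∀ {i i'} → i < m → i' < m → i ≢ i' →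
    2 * (w1 + w2) ∸ 1 ≤ hamming (codeword i) (codeword i')
  distance-codewords {i} {i'} i<m i'<m i≢i' = m≤n+o⇒m∸n≤o (2 * w) 1 (begin
    2 * w
      ≡⟨ cong (w +_) (+-identityʳ w) ⟩
    w + w
      ≡⟨ sym (cong₂ _+_ (supportSize x (composition-codeword i<m)) (supportSize y (composition-codeword i'<m))) ⟩
    letterSum inSupport x + letterSum inSupport y
      ≤⟨ supports≤distance+loss x y ⟩
    hamming x y + pairSum distanceLoss x y
      ≤⟨ +-monoʳ-≤ (hamming x y) (loss-codewords i<m i'<m i≢i') ⟩
    hamming x y + 1
      ≡⟨ +-comm (hamming x y) 1 ⟩
    1 + hamming x y ∎)
    where
    open ≤-Reasoning
    w = w1 + w2
    x = codeword i
    y = codeword i'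

  codeword-injective : ∀ {i i'} → i < m → i' < m → i ≢ i' → codeword i ≢ codeword i'
  codeword-injective {i} i<m i'<m i≢i' same = <⇒≱ (s≤s z≤n) (begin
    1                                    ≤⟨ ∸-monoˡ-≤ 1 (*-monoʳ-≤ 2 (≤-trans w1≥1 (m≤m+n w1 w2))) ⟩
    2 * (w1 + w2) ∸ 1                    ≤⟨ distance-codewords i<m i'<m i≢i' ⟩
    hamming (codeword i) (codeword _)    ≡⟨ cong (hamming (codeword i)) (sym same) ⟩
    hamming (codeword i) (codeword i)    ≡⟨ hamming-self (codeword i) ⟩
    0                                    ∎)
    where open ≤-Reasoning

  code : CCCode (m * w1 + r) (2 * (w1 + w2) ∸ 1) w1 w2
  code = record
    { words = applyUpTo codeword m
    ; distinct = Unique.applyUpTo⁺₁ codeword m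
        (λ i<j j<m → codeword-injective (<-trans i<j j<m) j<m (<⇒≢ i<j))
    ; composition = applyUpTo⁺₁ codeword m composition-codeword
    ; minDist = farApart
    }
    where
    farApart : ∀ {x y} → x ∈ applyUpTo codeword m → y ∈ applyUpTo codeword m → x ≢ y →
      2 * (w1 + w2) ∸ 1 ≤ hamming x y
    farApart x∈ y∈ x≢y with ∈-applyUpTo⁻ codeword x∈ | ∈-applyUpTo⁻ codeword y∈
    ... | i , i<m , refl | i' , i'<m , refl = distance-codewords i<m i'<m (λ i≡i' → x≢y (cong codeword i≡i'))

  code-size : size code ≡ m
  code-size = length-applyUpTo codeword m

castCode : ∀ {L L' d w1 w2} → L ≡ L' → (C : CCCode L d w1 w2) →
  Σ (CCCode L' d w1 w2) (λ C' → size C' ≡ size C)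
castCode refl C = C , refl

floor-exact : ∀ q k w1 .{{_ : NonZero w1}} → k < w1 → (q * w1 + k) / w1 ≡ q
floor-exact q k w1 k<w1 = begin
  (q * w1 + k) / w1     ≡⟨ +-distrib-/-∣ˡ k (n∣m*n q) ⟩
  q * w1 / w1 + k / w1  ≡⟨ cong₂ _+_ (m*n/n≡m q w1) (m<n⇒m/n≡0 k<w1) ⟩
  q + 0                 ≡⟨ +-identityʳ q ⟩
  q                     ∎
  where open ≡-Reasoning

-- the threshold 2·w1·w2 with the factors in the order used by division
threshold-comm : ∀ w1 w2 → 2 * w1 * w2 ≡ 2 * w2 * w1
threshold-comm = solve-∀

division : ∀ n w1 .{{_ : NonZero w1}} → n / w1 * w1 + n % w1 ≡ n
division n w1 = trans (+-comm (n / w1 * w1) (n % w1)) (sym (m≡m%n+[m/n]*n n w1))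

-- For n ≥ 2·w2·w1 + w2 a cycle for the construction exists: with q = ⌊n/w1⌋
-- and r = n mod w1 take M = q + 1 blocks if w2 ≤ r and M = q otherwise;
-- n is large enough that 2·w2 < M in both cases.
cycleLength : ∀ w1 w2 n .{{_ : NonZero w1}} → 2 * w2 * w1 + w2 ≤ n →
  Σ ℕ (λ M → (2 * w2 < M) × ((M ≡ n / w1) ⊎ (M ≡ suc (n / w1) × w2 ≤ n % w1)))
cycleLength w1 w2 n N≤n with w2 ≤? n % w1
... | yes w2≤r = suc q , s≤s q≥2w2 , inj₂ (refl , w2≤r)
  where
  q = n / w1
  -- q < 2·w2 would make n < (q + 1)·w1 ≤ 2·w2·w1
  q≥2w2 : 2 * w2 ≤ q
  q≥2w2 = ≮⇒≥ λ q<2w2 → <⇒≱ (begin-strict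
    n                   ≡⟨ sym (division n w1) ⟩
    q * w1 + n % w1     <⟨ +-monoʳ-< (q * w1) (m%n<n n w1) ⟩
    q * w1 + w1         ≡⟨ +-comm (q * w1) w1 ⟩
    suc q * w1          ≤⟨ *-monoˡ-≤ w1 q<2w2 ⟩
    2 * w2 * w1         ≤⟨ m≤m+n (2 * w2 * w1) w2 ⟩
    2 * w2 * w1 + w2    ∎) N≤n
    where open ≤-Reasoning
... | no w2≰r = q , q>2w2 , inj₁ refl
  where
  q = n / w1
  -- q ≤ 2·w2 would make n < 2·w2·w1 + w2, as n mod w1 < w2
  q>2w2 : 2 * w2 < q
  q>2w2 = ≰⇒> λ q≤2w2 → <⇒≱ (begin-strict
    n                   ≡⟨ sym (division n w1) ⟩
    q * w1 + n % w1     <⟨ +-monoʳ-< (q * w1) (≰⇒> w2≰r) ⟩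
    q * w1 + w2         ≤⟨ +-monoˡ-≤ w2 (*-monoˡ-≤ w1 q≤2w2) ⟩
    2 * w2 * w1 + w2    ∎) N≤n
    where open ≤-Reasoning

largeLengths : ∀ w1 w2 .{{_ : NonZero w1}} → 1 ≤ w2 → w2 ≤ w1 →
  Admissible w1 w2 (2 * w1 * w2 + w2)
largeLengths w1 w2 w2≥1 w2≤w1 n n≥N = code-of-size-q , λ C → codeSize≤ C
  where
  N≤n : 2 * w2 * w1 + w2 ≤ n
  N≤n = ≤-trans (≤-reflexive (cong (_+ w2) (sym (threshold-comm w1 w2)))) n≥N
  cycle : Σ ℕ (λ M → (2 * w2 < M) × ((M ≡ n / w1) ⊎ (M ≡ suc (n / w1) × w2 ≤ n % w1)))
  cycle = cycleLength w1 w2 n N≤n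
  open Construction w1 w2 (n / w1) (n % w1) (proj₁ cycle) (≤-trans w2≥1 w2≤w1) w2≤w1
                    (proj₁ (proj₂ cycle)) (proj₂ (proj₂ cycle))
  code-of-size-q : Σ (CCCode n (2 * (w1 + w2) ∸ 1) w1 w2) (λ C → size C ≡ n / w1)
  code-of-size-q = let (C , size≡) = castCode (division n w1) code in C , trans size≡ code-size

smallThresholds : ∀ w1 w2 .{{_ : NonZero w1}} → 1 ≤ w2 → w2 ≤ w1 →
  ∀ n₀ → n₀ < 2 * w1 * w2 + w2 → ¬ Admissible w1 w2 n₀
smallThresholds w1 (suc k) _ k<w1 n₀ n₀<N admissible
  with admissible (2 * w1 * suc k + k) (s≤s⁻¹ (≤-trans n₀<N (≤-reflexive (+-suc (2 * w1 * suc k) k))))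
... | (C , size≡) , _ = noCodeBelowThreshold w1 k C (begin
  size C                              ≡⟨ size≡ ⟩
  (2 * w1 * suc k + k) / w1           ≡⟨ cong (λ len → (len + k) / w1) (threshold-comm w1 (suc k)) ⟩
  (2 * suc k * w1 + k) / w1           ≡⟨ floor-exact (2 * suc k) k w1 k<w1 ⟩
  2 * suc k                           ∎)
  where open ≡-Reasoning

proposition8 : ∀ (w1 w2 : ℕ) .{{_ : NonZero w1}} → 1 ≤ w2 → w2 ≤ w1 →
    Nccc≡ w1 w2 (2 * w1 * w2 + w2)
proposition8 w1 w2 w2≥1 w2≤w1 = largeLengths w1 w2 w2≥1 w2≤w1 , smallThresholds w1 w2 w2≥1 w2≤w1
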